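{- Let $d\geq 2$, $k\geq 3$, $t$, $h$, $n$, $\lambda$ be positive integers with $1\leq t\leq k$, and let $p\in (0, 1/2)$ be a real number. Suppose that \[p^{(\lambda+1)d}n\geq 1\qquad\text{and}\qquad n^{ -1} \geq \left(\frac{h}{n}\right)^{\lambda d}\binom{kn}{d}2^{\binom{d}{k-1}}.\] Let $G$ be a $k$-partite $k$-uniform hypergraph on vertex set $V_1\sqcup\cdots\sqcup V_k$ with $n$ vertices in each part and at least $pn^k$ edges. If $G$ is $(h, (\lambda+1)d)$-vertex-extending to $V_r$ for all $r < t$, then there exists a subhypergraph $G'$ of $G$ on the same vertex set with at least $p^{(\lambda+1)d}n^k$ edges that is $(h, d)$-vertex-extending to $V_r$ for all $r \leq t$.
   Context: Let $G$ be a $k$-partite $k$-uniform hypergraph with vertex parts $V_1,\dots,V_k$ (each edge has exactly one vertex in each part). Write $V_{ -t} = \bigcup_{i\neq t} V_i$. The $(k-2)$-skeleton $G^{(k-2)}$ is the $(k-1)$-uniform hypergraph on $V(G)$ whose edges are the $(k-1)$-sets contained in some edge of $G$; for $S\subseteq V(G)$, $G^{(k-2)}[S]$ denotes its subhypergraph induced on $S$. For a set $F$ of edges of $G^{(k-2)}$, a vertex $v$ is a mutual extension of $F$ if $e\cup\{v\}\in E(G)$ for every $e\in F$. For real $a>0$ and positive integer $d$, $G$ is $(a,d)$-vertex-extending to $V_t$ if for every set $S$ of at most $d$ vertices in $V_{ -t}$, the edge set $E(G^{(k-2)}[S])$ has at least $a$ mutual extensions (in $V_t$).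
   Formalization: The parameter p ranges over the rationals in (0, 1/2) rather than the real numbers. -}

module Defs where

open import Data.Nat using (ℕ; zero; suc; _≤_)
open import Data.Fin using (Fin)
open import Data.Vec using (Vec; []; _∷_; lookup; _[_]≔_)
open import Data.List using (List; [_]; map; concatMap; length; filterᵇ; allFin)
open import Data.List.Membership.Propositional using (_∈_)
open import Data.Bool using (Bool; true)
open import Data.Product using (_×_; _,_; proj₁; ∃)
open import Data.Integer using (+_)
open import Data.Rational using (ℚ; _/_; _*_; 1ℚ)
open import Relation.Binary.PropositionalEquality using (_≡_; _≢_)
open import Function.Definitions using (Injective)

ℕ→ℚ : ℕ → ℚ
ℕ→ℚ m = + m / 1

_^ℚ_ : ℚ → ℕ → ℚ
p ^ℚ zero  = 1ℚ
p ^ℚ suc m = p * (p ^ℚ m)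

-- A k-partite k-uniform hypergraph with parts V_0,…,V_{k-1}, each V_i a copy
-- of Fin n.  A potential
-- edge picks exactly one vertex from each part, i.e. is a vector Vec (Fin n) k
-- (coordinate i = the vertex in part V_i).
Vertex : ℕ → ℕ → Set
Vertex k n = Fin k × Fin n

Edge : ℕ → ℕ → Set
Edge k n = Vec (Fin n) k

Hypergraph : ℕ → ℕ → Set
Hypergraph k n = Edge k n → Bool

IsEdge : ∀ {k n} → Hypergraph k n → Edge k n → Set
IsEdge G e = G e ≡ true

allEdges : ∀ k n → List (Edge k n)
allEdges zero    n = [ [] ]
allEdges (suc k) n = concatMap (λ x → map (x ∷_) (allEdges k n)) (allFin n)

numEdges : ∀ {k n} → Hypergraph k n → ℕ
numEdges {k} {n} G = length (filterᵇ G (allEdges k n))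

_⊆ᴴ_ : ∀ {k n} → Hypergraph k n → Hypergraph k n → Set
G' ⊆ᴴ G = ∀ e → IsEdge G' e → IsEdge G e

-- Since S avoids V_t, a (k-1)-set inside S contained in an edge e of G is
-- exactly {(i , e_i) : i ≠ t} for an edge e of G all of whose vertices outside
-- part t lie in S; adding the vertex x ∈ V_t to it gives the k-set e[t ≔ x].
MutualExt : ∀ {k n} → Hypergraph k n → List (Vertex k n) → Fin k → Fin n → Set
MutualExt G S t x =
  ∀ e → IsEdge G e → (∀ i → i ≢ t → (i , lookup e i) ∈ S) → IsEdge G (e [ t ]≔ x)

-- (a , d)-vertex-extending to V_t: for every set S of at most d vertices in
-- V_{-t} (given as a list of length ≤ d), there are at least a mutual
-- extensions in V_t (an injection Fin a → V_t landing in mutual extensions).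
VertexExtending : ∀ {k n} → Hypergraph k n → ℕ → ℕ → Fin k → Set
VertexExtending {k} {n} G a d t =
  ∀ (S : List (Vertex k n)) → length S ≤ d → (∀ v → v ∈ S → proj₁ v ≢ t) →
  ∃ λ (f : Fin a → Fin n) → Injective _≡_ _≡_ f × (∀ j → MutualExt G S t (f j))

{-# OPTIONS --safe #-}
module Submission where

-- Dependent random choice.  Write p = a / b, m = l d and M = m + d.  For a sample
-- X ∈ V_t^m let G_X keep the edges of G whose (k-1)-face outside V_t is extended by every
-- vertex of X.  Summed over all n^m samples, the power-mean inequality applied to the
-- degrees of the faces gives ∑_X |E(G_X)| ≥ p^(m+1) n^m n^k.  Call X bad if some family F of
-- (k-1)-subsets of a d-set has fewer than h mutual extensions yet all of X are among them;
-- each F captures fewer than h^m samples, so at most C(kn, d) 2^C(d, k-1) h^m ≤ n^(m-1)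
-- samples are bad.  If no good X had |E(G_X)| ≥ p^M n^k, the two bounds would give
-- p^(m+1) ≤ 1/n + p^M ≤ 2 p^M, impossible for p < 1/2 and d ≥ 2.  For a good X and S ⊆ σ with
-- |σ| = d, the (k-1)-subsets of σ mutually extended in G by all of X form such a family, so
-- its at least h mutual extensions all extend S in G_X.  For r < t, a mutual extension in G
-- of S together with X is one of S in G_X.

open import Defs
open import Data.Bool using (Bool; true; false; _∧_; _∨_; T)
open import Data.Bool.ListAction using (any)
import Data.Bool.Properties as Bool
open import Data.Bool.Properties using (∧-identityʳ; ∧-conicalˡ; ∧-conicalʳ; ∨-conicalˡ; ∨-conicalʳ)
open import Data.Fin as Fin using (Fin; zero; suc; punchIn; punchOut)
  renaming (_<_ to _<ᶠ_; _≤_ to _≤ᶠ_)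
open import Data.Fin.Properties as Fin using (injective⇒≤; punchIn-injective; punchInᵢ≢i; punchIn-punchOut)
open import Data.List as List
  using (List; []; _∷_; [_]; _++_; map; concatMap; length; filter; filterᵇ; allFin; cartesianProduct)
open import Data.List.Properties
  using (map-++; map-∘; map-cong; map-cong-local; map-tabulate; length-tabulate; length-map; length-++; filter-notAll)
open import Data.List.Membership.Propositional using (_∈_)
open import Data.List.Membership.Propositional.Properties
  using (∈-allFin; ∈-map⁺; ∈-map⁻; ∈-concatMap⁺; ∈-++⁺ˡ; ∈-++⁺ʳ; ∈-++⁻; ∈-filter⁺; ∈-filter⁻; ∈-cartesianProduct⁺)
import Data.List.Membership.DecPropositional as DecMembership
open import Data.List.Relation.Binary.Subset.Propositional using (_⊆_)
open import Data.List.Relation.Unary.All as All using (All)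
open import Data.List.Relation.Unary.Any as Any using (here; there; index)
open import Data.List.Relation.Unary.Any.Properties using (lookup-index)
open import Data.Nat using (ℕ; zero; suc; _+_; _*_; _^_; _∸_; _≤_; _<_; _≤?_; _<ᵇ_; z≤n; s≤s; NonZero; >-nonZero)
open import Data.Nat.Combinatorics using (_C_; nCk+nC[k+1]≡[n+1]C[k+1])
open import Data.Nat.ListAction using (sum)
open import Data.Nat.ListAction.Properties using (sum-++)
open import Data.Nat.Properties
open import Data.Nat.Tactic.RingSolver using (solve-∀)
open import Data.Product using (_×_; _,_; ∃; proj₁; proj₂)
open import Data.Product.Properties using (≡-dec)
open import Data.Rational using (ℚ; 0ℚ; ½; 1ℚ) renaming (_*_ to _*ℚ_; _≤_ to _≤ℚ_; _<_ to _<ℚ_)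
open import Data.Sum using (inj₁; inj₂; [_,_]′)
open import Data.Vec as Vec using (Vec; []; _∷_; lookup; _[_]≔_)
open import Data.Vec.Properties
  using (tabulate∘lookup; tabulate-cong; []≔-idempotent; []≔-commutes; lookup∘update; lookup∘update′)
open import Function using (_∘_; case_of_)
open import Function.Bundles using (_⇔_; mk⇔; Equivalence)
open import Function.Definitions using (Injective)
open import Level using (Level)
open import Relation.Binary.Definitions using (DecidableEquality)
open import Relation.Binary.PropositionalEquality hiding ([_])
open import Relation.Nullary using (Dec; does; yes; no; ¬_; ¬?; contradiction)
open import Relation.Nullary.Decidable using (map′; _→-dec_; _×-dec_; dec-true)
open import Relation.Unary using (Decidable)

private
  variable
    a b : Level
    A : Set a
    B : Set b

𝟙 : Bool → ℕ
𝟙 true  = 1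
𝟙 false = 0

𝟙≤1 : ∀ b → 𝟙 b ≤ 1
𝟙≤1 true  = ≤-refl
𝟙≤1 false = z≤n

𝟙-∧ : ∀ b c → 𝟙 (b ∧ c) ≡ 𝟙 b * 𝟙 c
𝟙-∧ true  c = sym (+-identityʳ (𝟙 c))
𝟙-∧ false c = refl

𝟙-∨ : ∀ b c → 𝟙 (b ∨ c) ≤ 𝟙 b + 𝟙 c
𝟙-∨ true  c = s≤s z≤n
𝟙-∨ false c = ≤-refl

∑ : List A → (A → ℕ) → ℕ
∑ xs f = sum (map f xs)

infixr 5 ∑
syntax ∑ xs (λ x → e) = ∑[ x ∈ xs ] e

∑-cong : ∀ xs {f g : A → ℕ} → (∀ x → f x ≡ g x) → ∑ xs f ≡ ∑ xs g
∑-cong xs f≗g = cong sum (map-cong f≗g xs)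

∑-cong-∈ : ∀ xs {f g : A → ℕ} → (∀ {x} → x ∈ xs → f x ≡ g x) → ∑ xs f ≡ ∑ xs g
∑-cong-∈ xs f≗g = cong sum (map-cong-local (All.tabulate f≗g))

∑-mono : ∀ xs {f g : A → ℕ} → (∀ x → f x ≤ g x) → ∑ xs f ≤ ∑ xs g
∑-mono []       f≤g = z≤n
∑-mono (x ∷ xs) f≤g = +-mono-≤ (f≤g x) (∑-mono xs f≤g)

∑-++ : ∀ xs ys (f : A → ℕ) → ∑ (xs ++ ys) f ≡ ∑ xs f + ∑ ys f
∑-++ xs ys f = trans (cong sum (map-++ f xs ys)) (sum-++ (map f xs) (map f ys))

∑-map : ∀ (g : A → B) xs (f : B → ℕ) → ∑ (map g xs) f ≡ ∑[ x ∈ xs ] f (g x)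
∑-map g xs f = cong sum (sym (map-∘ xs))

∑-concatMap : ∀ (g : A → List B) xs (f : B → ℕ) → ∑ (concatMap g xs) f ≡ ∑[ x ∈ xs ] ∑ (g x) f
∑-concatMap g []       f = refl
∑-concatMap g (x ∷ xs) f = trans (∑-++ (g x) (concatMap g xs) f) (cong (∑ (g x) f +_) (∑-concatMap g xs f))

∑-+ : ∀ xs (f g : A → ℕ) → ∑[ x ∈ xs ] (f x + g x) ≡ ∑ xs f + ∑ xs g
∑-+ []       f g = refl
∑-+ (x ∷ xs) f g = trans (cong (f x + g x +_) (∑-+ xs f g)) (interchange (f x) (g x) _ _)
  where
  interchange : ∀ a b c d → (a + b) + (c + d) ≡ (a + c) + (b + d)
  interchange = solve-∀

∑-*ˡ : ∀ c xs (f : A → ℕ) → ∑[ x ∈ xs ] (c * f x) ≡ c * ∑ xs f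
∑-*ˡ c []       f = sym (*-zeroʳ c)
∑-*ˡ c (x ∷ xs) f = trans (cong (c * f x +_) (∑-*ˡ c xs f)) (sym (*-distribˡ-+ c (f x) _))

∑-*ʳ : ∀ c xs (f : A → ℕ) → ∑[ x ∈ xs ] (f x * c) ≡ ∑ xs f * c
∑-*ʳ c xs f = trans (∑-cong xs (λ x → *-comm (f x) c)) (trans (∑-*ˡ c xs f) (*-comm c _))

∑-const : ∀ (xs : List A) c → ∑[ x ∈ xs ] c ≡ length xs * c
∑-const []       c = refl
∑-const (x ∷ xs) c = cong (c +_) (∑-const xs c)

∑-≤-length* : ∀ xs {f : A → ℕ} {c} → (∀ x → f x ≤ c) → ∑ xs f ≤ length xs * c
∑-≤-length* xs {c = c} f≤c = ≤-trans (∑-mono xs f≤c) (≤-reflexive (∑-const xs c))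

∑-comm : ∀ xs ys (f : A → B → ℕ) → ∑[ x ∈ xs ] ∑[ y ∈ ys ] f x y ≡ ∑[ y ∈ ys ] ∑[ x ∈ xs ] f x y
∑-comm []       ys f = sym (trans (∑-const ys 0) (*-zeroʳ (length ys)))
∑-comm (x ∷ xs) ys f = trans (cong (∑ ys (f x) +_) (∑-comm xs ys f)) (sym (∑-+ ys (f x) _))

length-filterᵇ : ∀ (p : A → Bool) xs → length (filterᵇ p xs) ≡ ∑[ x ∈ xs ] 𝟙 (p x)
length-filterᵇ p []       = refl
length-filterᵇ p (x ∷ xs) with p x
... | true  = cong suc (length-filterᵇ p xs)
... | false = length-filterᵇ p xs

𝟙-any : ∀ (p : A → Bool) xs → 𝟙 (any p xs) ≤ ∑[ x ∈ xs ] 𝟙 (p x)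
𝟙-any p []       = z≤n
𝟙-any p (x ∷ xs) = ≤-trans (𝟙-∨ (p x) (any p xs)) (+-monoʳ-≤ (𝟙 (p x)) (𝟙-any p xs))

any-≡false : ∀ (p : A → Bool) {xs x} → any p xs ≡ false → x ∈ xs → p x ≡ false
any-≡false p {y ∷ xs} p∨any≡false (here refl)  = ∨-conicalˡ _ _ p∨any≡false
any-≡false p {y ∷ xs} p∨any≡false (there x∈xs) = any-≡false p (∨-conicalʳ _ _ p∨any≡false) x∈xs

-- The power-mean inequality

mixed-powers-≤ : ∀ r x y → x * y ^ r + y * x ^ r ≤ x ^ suc r + y ^ suc r
mixed-powers-≤ r x y = [ ordered , (λ y≤x → subst₂ _≤_ (+-comm (y * x ^ r) _) (+-comm (y ^ suc r) _) (ordered y≤x)) ]′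
                         (≤-total x y)
  where
  gap : ∀ x δ → x * (x + δ) ^ r + (x + δ) * x ^ r ≤ x ^ suc r + (x + δ) ^ suc r
  gap x δ = begin
    x * (x + δ) ^ r + (x + δ) * x ^ r                ≡⟨ e₁ x δ (x ^ r) ((x + δ) ^ r) ⟩
    (x * x ^ r + x * (x + δ) ^ r) + δ * x ^ r        ≤⟨ +-monoʳ-≤ _ (*-monoʳ-≤ δ (^-monoˡ-≤ r (m≤m+n x δ))) ⟩
    (x * x ^ r + x * (x + δ) ^ r) + δ * (x + δ) ^ r  ≡⟨ e₂ x δ (x ^ r) ((x + δ) ^ r) ⟩
    x * x ^ r + (x + δ) * (x + δ) ^ r                ∎
    where
    open ≤-Reasoning
    e₁ : ∀ x δ xʳ yʳ → x * yʳ + (x + δ) * xʳ ≡ (x * xʳ + x * yʳ) + δ * xʳ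
    e₁ = solve-∀
    e₂ : ∀ x δ xʳ yʳ → (x * xʳ + x * yʳ) + δ * yʳ ≡ x * xʳ + (x + δ) * yʳ
    e₂ = solve-∀
  ordered : ∀ {x y} → x ≤ y → x * y ^ r + y * x ^ r ≤ x ^ suc r + y ^ suc r
  ordered {x} {y} x≤y =
    subst (λ y → x * y ^ r + y * x ^ r ≤ x ^ suc r + y ^ suc r) (m+[n∸m]≡n x≤y) (gap x (y ∸ x))

chebyshev-∑ : ∀ (xs : List A) (f : A → ℕ) r →
  ∑ xs f * (∑[ x ∈ xs ] f x ^ r) ≤ length xs * (∑[ x ∈ xs ] f x ^ suc r)
chebyshev-∑ {A = A} xs f r = *-cancelˡ-≤ 2 (begin
  2 * (F * Fʳ)                                                          ≡⟨ double (F * Fʳ) ⟩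
  F * Fʳ + F * Fʳ                                                       ≡⟨ cong₂ _+_ mixed₁ mixed₂ ⟨
  (∑[ x ∈ xs ] ∑[ y ∈ xs ] f x * f y ^ r) + (∑[ x ∈ xs ] ∑[ y ∈ xs ] f y * f x ^ r)
                                                                        ≡⟨ ∑∑-+ _ _ ⟨
  (∑[ x ∈ xs ] ∑[ y ∈ xs ] f x * f y ^ r + f y * f x ^ r)
    ≤⟨ ∑-mono xs (λ x → ∑-mono xs (λ y → mixed-powers-≤ r (f x) (f y))) ⟩
  (∑[ x ∈ xs ] ∑[ y ∈ xs ] f x ^ suc r + f y ^ suc r)                   ≡⟨ ∑∑-+ _ _ ⟩
  (∑[ x ∈ xs ] ∑[ y ∈ xs ] f x ^ suc r) + (∑[ x ∈ xs ] Fʳ⁺¹)           ≡⟨ cong₂ _+_ diagonal (∑-const xs Fʳ⁺¹) ⟩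
  N * Fʳ⁺¹ + N * Fʳ⁺¹                                                   ≡⟨ double (N * Fʳ⁺¹) ⟨
  2 * (N * Fʳ⁺¹)                                                        ∎)
  where
  open ≤-Reasoning
  F = ∑ xs f
  Fʳ = ∑[ x ∈ xs ] f x ^ r
  Fʳ⁺¹ = ∑[ x ∈ xs ] f x ^ suc r
  N = length xs
  double : ∀ a → 2 * a ≡ a + a
  double a = cong (a +_) (+-identityʳ a)
  ∑∑-+ : ∀ (g h : A → A → ℕ) →
    (∑[ x ∈ xs ] ∑[ y ∈ xs ] g x y + h x y) ≡ (∑[ x ∈ xs ] ∑[ y ∈ xs ] g x y) + (∑[ x ∈ xs ] ∑[ y ∈ xs ] h x y)
  ∑∑-+ g h = trans (∑-cong xs (λ x → ∑-+ xs (g x) (h x))) (∑-+ xs _ _)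
  mixed₁ : (∑[ x ∈ xs ] ∑[ y ∈ xs ] f x * f y ^ r) ≡ F * Fʳ
  mixed₁ = trans (∑-cong xs (λ x → ∑-*ˡ (f x) xs _)) (∑-*ʳ Fʳ xs f)
  mixed₂ : (∑[ x ∈ xs ] ∑[ y ∈ xs ] f y * f x ^ r) ≡ F * Fʳ
  mixed₂ = trans (∑-cong xs (λ x → ∑-*ʳ (f x ^ r) xs f)) (∑-*ˡ F xs _)
  diagonal : (∑[ x ∈ xs ] ∑[ y ∈ xs ] f x ^ suc r) ≡ N * Fʳ⁺¹
  diagonal = trans (∑-cong xs (λ x → ∑-const xs (f x ^ suc r))) (∑-*ˡ N xs _)

power-mean-∑ : ∀ (xs : List A) (f : A → ℕ) m →
  ∑ xs f ^ suc m ≤ length xs ^ m * (∑[ x ∈ xs ] f x ^ suc m)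
power-mean-∑ xs f zero = ≤-reflexive (begin
  ∑ xs f * 1                    ≡⟨ *-identityʳ _ ⟩
  ∑ xs f                        ≡⟨ ∑-cong xs (λ x → *-identityʳ (f x)) ⟨
  (∑[ x ∈ xs ] f x ^ 1)         ≡⟨ +-identityʳ _ ⟨
  1 * (∑[ x ∈ xs ] f x ^ 1)     ∎)
  where open ≡-Reasoning
power-mean-∑ xs f (suc m) = begin
  F * F ^ suc m                                    ≤⟨ *-monoʳ-≤ F (power-mean-∑ xs f m) ⟩
  F * (N ^ m * (∑[ x ∈ xs ] f x ^ suc m))          ≡⟨ x*[y*z]≡y*[x*z] F (N ^ m) _ ⟩
  N ^ m * (F * (∑[ x ∈ xs ] f x ^ suc m))          ≤⟨ *-monoʳ-≤ (N ^ m) (chebyshev-∑ xs f (suc m)) ⟩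
  N ^ m * (N * (∑[ x ∈ xs ] f x ^ suc (suc m)))    ≡⟨ x*[y*z]≡y*[x*z] (N ^ m) N _ ⟩
  N * (N ^ m * (∑[ x ∈ xs ] f x ^ suc (suc m)))    ≡⟨ *-assoc N (N ^ m) _ ⟨
  N * N ^ m * (∑[ x ∈ xs ] f x ^ suc (suc m))      ∎
  where
  open ≤-Reasoning
  F = ∑ xs f
  N = length xs
  x*[y*z]≡y*[x*z] : ∀ x y z → x * (y * z) ≡ y * (x * z)
  x*[y*z]≡y*[x*z] = solve-∀

choose : List A → ℕ → List (List A)
choose xs       zero    = [ [] ]
choose []       (suc j) = []
choose (x ∷ xs) (suc j) = map (x ∷_) (choose xs j) ++ choose xs (suc j)

length-choose : ∀ (xs : List A) j → length (choose xs j) ≡ length xs C j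
length-choose xs       zero    = refl
length-choose []       (suc j) = refl
length-choose (x ∷ xs) (suc j) = begin
  length (map (x ∷_) (choose xs j) ++ choose xs (suc j))           ≡⟨ length-++ (map (x ∷_) (choose xs j)) ⟩
  length (map (x ∷_) (choose xs j)) + length (choose xs (suc j))
    ≡⟨ cong₂ _+_ (trans (length-map (x ∷_) (choose xs j)) (length-choose xs j)) (length-choose xs (suc j)) ⟩
  length xs C j + length xs C suc j                                ≡⟨ nCk+nC[k+1]≡[n+1]C[k+1] (length xs) j ⟩
  suc (length xs) C suc j                                          ∎
  where open ≡-Reasoning

length-∈-choose : ∀ (xs : List A) j {σ} → σ ∈ choose xs j → length σ ≡ j
length-∈-choose xs       zero    (here refl) = refl
length-∈-choose (x ∷ xs) (suc j) σ∈ with ∈-++⁻ (map (x ∷_) (choose xs j)) σ∈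
... | inj₁ σ∈₁ with ∈-map⁻ (x ∷_) σ∈₁
...   | τ , τ∈ , refl = cong suc (length-∈-choose xs j τ∈)
length-∈-choose (x ∷ xs) (suc j) σ∈ | inj₂ σ∈₂ = length-∈-choose xs (suc j) σ∈₂

∈-choose-length : ∀ (xs : List A) → xs ∈ choose xs (length xs)
∈-choose-length []       = here refl
∈-choose-length (x ∷ xs) = ∈-++⁺ˡ (∈-map⁺ (x ∷_) (∈-choose-length xs))

module _ (_≟_ : DecidableEquality A) where

  open DecMembership _≟_ using (_∈?_)

  -- Walk along xs, taking x into σ when x ∈ L or when the rest of xs is too short to skip it.
  ⊆-choose : ∀ xs j (L : List A) → length L ≤ j → j ≤ length xs → L ⊆ xs →
    ∃ λ σ → σ ∈ choose xs j × L ⊆ σ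
  ⊆-choose xs       zero    []      _ _ _ = [] , here refl , λ ()
  ⊆-choose []       (suc j) L       _ () _
  ⊆-choose (x ∷ xs) (suc j) L |L|≤1+j 1+j≤|x∷xs| L⊆x∷xs with x ∈? L
  ... | yes x∈L =
    let (σ , σ∈ , L-x⊆σ) = ⊆-choose xs j L-x |L-x|≤j (≤-pred 1+j≤|x∷xs|) L-x⊆xs
    in x ∷ σ , ∈-++⁺ˡ (∈-map⁺ (x ∷_) σ∈) , λ {v} v∈L → case v ≟ x of λ where
         (yes refl) → here refl
         (no v≢x)   → there (L-x⊆σ (∈-filter⁺ (¬? ∘ (_≟ x)) v∈L v≢x))
    where
    L-x = filter (¬? ∘ (_≟ x)) L
    |L-x|≤j : length L-x ≤ j
    |L-x|≤j = ≤-pred (≤-trans (filter-notAll (¬? ∘ (_≟ x)) L (Any.map (λ { refl x≢x → x≢x refl }) x∈L)) |L|≤1+j)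
    L-x⊆xs : L-x ⊆ xs
    L-x⊆xs v∈ with ∈-filter⁻ (¬? ∘ (_≟ x)) v∈
    ... | v∈L , v≢x with L⊆x∷xs v∈L
    ...   | here v≡x   = contradiction v≡x v≢x
    ...   | there v∈xs = v∈xs
  ... | no x∉L with suc j ≤? length xs
  ...   | yes 1+j≤|xs| =
    let (σ , σ∈ , L⊆σ) = ⊆-choose xs (suc j) L |L|≤1+j 1+j≤|xs| (λ v∈L → drop-x (L⊆x∷xs v∈L) v∈L)
    in σ , ∈-++⁺ʳ (map (x ∷_) (choose xs j)) σ∈ , L⊆σ
    where
    drop-x : ∀ {v} → v ∈ x ∷ xs → v ∈ L → v ∈ xs
    drop-x (here refl)  v∈L = contradiction v∈L x∉L
    drop-x (there v∈xs) _   = v∈xs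
  ...   | no 1+j≰|xs| =
    x ∷ xs , subst (λ i → x ∷ xs ∈ choose (x ∷ xs) i) (≤-antisym (≰⇒> 1+j≰|xs|) 1+j≤|x∷xs|) (∈-choose-length (x ∷ xs))
           , L⊆x∷xs

sublists : List A → List (List A)
sublists []       = [ [] ]
sublists (x ∷ xs) = map (x ∷_) (sublists xs) ++ sublists xs

length-sublists : ∀ (xs : List A) → length (sublists xs) ≡ 2 ^ length xs
length-sublists []       = refl
length-sublists (x ∷ xs) = begin
  length (map (x ∷_) (sublists xs) ++ sublists xs)          ≡⟨ length-++ (map (x ∷_) (sublists xs)) ⟩
  length (map (x ∷_) (sublists xs)) + length (sublists xs)  ≡⟨ cong (_+ _) (length-map (x ∷_) (sublists xs)) ⟩
  length (sublists xs) + length (sublists xs)               ≡⟨ cong (λ s → s + s) (length-sublists xs) ⟩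
  2 ^ length xs + 2 ^ length xs                             ≡⟨ cong (2 ^ length xs +_) (+-identityʳ _) ⟨
  2 ^ suc (length xs)                                       ∎
  where open ≡-Reasoning

filter-∈-sublists : ∀ {p} {P : A → Set p} (P? : Decidable P) xs → filter P? xs ∈ sublists xs
filter-∈-sublists P? []       = here refl
filter-∈-sublists P? (x ∷ xs) with does (P? x)
... | true  = ∈-++⁺ˡ (∈-map⁺ (x ∷_) (filter-∈-sublists P? xs))
... | false = ∈-++⁺ʳ (map (x ∷_) (sublists xs)) (filter-∈-sublists P? xs)

length-cartesianProduct : ∀ (xs : List A) (ys : List B) →
  length (cartesianProduct xs ys) ≡ length xs * length ys
length-cartesianProduct []       ys = refl
length-cartesianProduct (x ∷ xs) ys =
  trans (length-++ (map (x ,_) ys)) (cong₂ _+_ (length-map (x ,_) ys) (length-cartesianProduct xs ys))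

length-concatMap : ∀ (f : A → List B) xs → length (concatMap f xs) ≡ ∑[ x ∈ xs ] length (f x)
length-concatMap f []       = refl
length-concatMap f (x ∷ xs) = trans (length-++ (f x)) (cong (length (f x) +_) (length-concatMap f xs))

length-allFin : ∀ n → length (allFin n) ≡ n
length-allFin n = length-tabulate {n = n} (λ i → i)

∑-allFin-suc : ∀ n (f : Fin (suc n) → ℕ) → ∑ (allFin (suc n)) f ≡ f zero + (∑[ x ∈ allFin n ] f (suc x))
∑-allFin-suc n f =
  cong (λ xs → f zero + sum xs) (trans (map-tabulate suc f) (sym (map-tabulate (λ x → x) (f ∘ suc))))

injective-∈⇒≤length : ∀ {m} {xs : List A} (v : Fin m → A) → Injective _≡_ _≡_ v → (∀ i → v i ∈ xs) →
  m ≤ length xs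
injective-∈⇒≤length {xs = xs} v v-inj v∈xs = injective⇒≤ {f = index ∘ v∈xs} λ {i} {j} eq →
  v-inj (trans (lookup-index (v∈xs i)) (trans (cong (List.lookup xs) eq) (sym (lookup-index (v∈xs j)))))

count⇒injection : ∀ n h (P : Fin n → Bool) → h ≤ (∑[ x ∈ allFin n ] 𝟙 (P x)) →
  ∃ λ (f : Fin h → Fin n) → Injective _≡_ _≡_ f × (∀ j → P (f j) ≡ true)
count⇒injection n       zero    P _ = (λ ()) , (λ { {()} }) , (λ ())
count⇒injection zero    (suc h) P ()
count⇒injection (suc n) (suc h) P h≤ with P zero in P0 | ≤-trans h≤ (≤-reflexive (∑-allFin-suc n (𝟙 ∘ P)))
... | true  | 1+h≤1+∑ = let (f , f-inj , Pf) = count⇒injection n h (P ∘ suc) (≤-pred 1+h≤1+∑) in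
  Fin.lift 1 f , Fin.lift-injective f f-inj 1 , λ { zero → P0 ; (suc j) → Pf j }
... | false | 1+h≤∑ = let (f , f-inj , Pf) = count⇒injection n (suc h) (P ∘ suc) 1+h≤∑ in
  suc ∘ f , f-inj ∘ Fin.suc-injective , Pf

does-true⇒ : ∀ {p} {P : Set p} (P? : Dec P) → does P? ≡ true → P
does-true⇒ (yes p) _ = p

∑-allEdges-∷ : ∀ k n (f : Edge (suc k) n → ℕ) →
  ∑ (allEdges (suc k) n) f ≡ ∑[ x ∈ allFin n ] ∑[ e ∈ allEdges k n ] f (x ∷ e)
∑-allEdges-∷ k n f =
  trans (∑-concatMap _ (allFin n) f) (∑-cong (allFin n) (λ x → ∑-map (x ∷_) (allEdges k n) f))

length-allEdges : ∀ k n → length (allEdges k n) ≡ n ^ k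
length-allEdges k n = trans (sym (trans (∑-const (allEdges k n) 1) (*-identityʳ _))) (count k)
  where
  count : ∀ k → ∑[ e ∈ allEdges k n ] 1 ≡ n ^ k
  count zero    = refl
  count (suc k) = begin
    ∑[ e ∈ allEdges (suc k) n ] 1              ≡⟨ ∑-allEdges-∷ k n _ ⟩
    ∑[ x ∈ allFin n ] ∑[ e ∈ allEdges k n ] 1  ≡⟨ ∑-cong (allFin n) (λ _ → count k) ⟩
    ∑[ x ∈ allFin n ] n ^ k                    ≡⟨ ∑-const (allFin n) (n ^ k) ⟩
    length (allFin n) * n ^ k                  ≡⟨ cong (_* n ^ k) (length-allFin n) ⟩
    n * n ^ k                                  ∎
    where open ≡-Reasoning

∈-allEdges : ∀ {k n} (e : Edge k n) → e ∈ allEdges k n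
∈-allEdges []                  = here refl
∈-allEdges {suc k} {n} (x ∷ e) =
  ∈-concatMap⁺ (λ y → map (y ∷_) (allEdges k n)) (Any.map (λ { refl → ∈-map⁺ (x ∷_) (∈-allEdges e) }) (∈-allFin x))

∀-Vec? : ∀ {p m n} {P : Vec (Fin n) m → Set p} → Decidable P → Dec (∀ X → P X)
∀-Vec? P? = map′ (λ all X → All.lookup all (∈-allEdges X)) (λ ∀P → All.tabulate (λ {X} _ → ∀P X)) (All.all? P? _)

∃-Vec? : ∀ {p m n} {P : Vec (Fin n) m → Set p} → Decidable P → Dec (∃ P)
∃-Vec? P? = map′ Any.satisfied (λ (X , PX) → Any.map (λ { refl → PX }) (∈-allEdges X)) (Any.any? P? _)

∑-allEdges-[]≔ : ∀ k n (t : Fin k) (φ : Edge k n → ℕ) →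
  (∑[ e ∈ allEdges k n ] ∑[ x ∈ allFin n ] φ (e [ t ]≔ x)) ≡ n * ∑ (allEdges k n) φ
∑-allEdges-[]≔ (suc k) n zero φ = begin
  (∑[ e ∈ allEdges (suc k) n ] ∑[ x ∈ allFin n ] φ (e [ zero ]≔ x))      ≡⟨ ∑-allEdges-∷ k n _ ⟩
  (∑[ y ∈ allFin n ] ∑[ e ∈ allEdges k n ] ∑[ x ∈ allFin n ] φ (x ∷ e))  ≡⟨ ∑-const (allFin n) _ ⟩
  length (allFin n) * (∑[ e ∈ allEdges k n ] ∑[ x ∈ allFin n ] φ (x ∷ e))
    ≡⟨ cong₂ _*_ (length-allFin n) (∑-comm (allEdges k n) (allFin n) _) ⟩
  n * (∑[ x ∈ allFin n ] ∑[ e ∈ allEdges k n ] φ (x ∷ e))                ≡⟨ cong (n *_) (∑-allEdges-∷ k n φ) ⟨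
  n * ∑ (allEdges (suc k) n) φ                                            ∎
  where open ≡-Reasoning
∑-allEdges-[]≔ (suc k) n (suc t) φ = begin
  (∑[ e ∈ allEdges (suc k) n ] ∑[ x ∈ allFin n ] φ (e [ suc t ]≔ x))     ≡⟨ ∑-allEdges-∷ k n _ ⟩
  (∑[ y ∈ allFin n ] ∑[ e ∈ allEdges k n ] ∑[ x ∈ allFin n ] φ (y ∷ (e [ t ]≔ x)))
    ≡⟨ ∑-cong (allFin n) (λ y → ∑-allEdges-[]≔ k n t (λ e → φ (y ∷ e))) ⟩
  (∑[ y ∈ allFin n ] n * (∑[ e ∈ allEdges k n ] φ (y ∷ e)))              ≡⟨ ∑-*ˡ n (allFin n) _ ⟩
  n * (∑[ y ∈ allFin n ] ∑[ e ∈ allEdges k n ] φ (y ∷ e))                ≡⟨ cong (n *_) (∑-allEdges-∷ k n φ) ⟨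
  n * ∑ (allEdges (suc k) n) φ                                            ∎
  where open ≡-Reasoning

numEdges-∑ : ∀ {k n} (H : Hypergraph k n) → numEdges H ≡ ∑[ e ∈ allEdges k n ] 𝟙 (H e)
numEdges-∑ {k} {n} H = length-filterᵇ H (allEdges k n)

numEdges-≤ : ∀ {k n} (H : Hypergraph k n) → numEdges H ≤ n ^ k
numEdges-≤ {k} {n} H = begin
  numEdges H                        ≡⟨ numEdges-∑ H ⟩
  (∑[ e ∈ allEdges k n ] 𝟙 (H e))   ≤⟨ ∑-≤-length* (allEdges k n) (λ e → 𝟙≤1 (H e)) ⟩
  length (allEdges k n) * 1         ≡⟨ trans (*-identityʳ _) (length-allEdges k n) ⟩
  n ^ k                             ∎
  where open ≤-Reasoning

allᵛ : ∀ {m n} → (Fin n → Bool) → Vec (Fin n) m → Bool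
allᵛ P []      = true
allᵛ P (x ∷ X) = P x ∧ allᵛ P X

allᵛ-lookup : ∀ {m n} {P : Fin n → Bool} (X : Vec (Fin n) m) → allᵛ P X ≡ true → ∀ j → P (lookup X j) ≡ true
allᵛ-lookup (x ∷ X) PX zero    = ∧-conicalˡ _ _ PX
allᵛ-lookup (x ∷ X) PX (suc j) = allᵛ-lookup X (∧-conicalʳ _ _ PX) j

allᵛ-tabulate : ∀ {m n} {P : Fin n → Bool} (X : Vec (Fin n) m) → (∀ j → P (lookup X j) ≡ true) → allᵛ P X ≡ true
allᵛ-tabulate []      PX = refl
allᵛ-tabulate (x ∷ X) PX = cong₂ _∧_ (PX zero) (allᵛ-tabulate X (PX ∘ suc))

∑-𝟙-allᵛ : ∀ m n (P : Fin n → Bool) →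
  (∑[ X ∈ allEdges m n ] 𝟙 (allᵛ P X)) ≡ (∑[ x ∈ allFin n ] 𝟙 (P x)) ^ m
∑-𝟙-allᵛ zero    n P = refl
∑-𝟙-allᵛ (suc m) n P = begin
  (∑[ X ∈ allEdges (suc m) n ] 𝟙 (allᵛ P X))                           ≡⟨ ∑-allEdges-∷ m n _ ⟩
  (∑[ x ∈ allFin n ] ∑[ X ∈ allEdges m n ] 𝟙 (P x ∧ allᵛ P X))
    ≡⟨ ∑-cong (allFin n) (λ x → ∑-cong (allEdges m n) (λ X → 𝟙-∧ (P x) _)) ⟩
  (∑[ x ∈ allFin n ] ∑[ X ∈ allEdges m n ] 𝟙 (P x) * 𝟙 (allᵛ P X))
    ≡⟨ ∑-cong (allFin n) (λ x → ∑-*ˡ (𝟙 (P x)) (allEdges m n) _) ⟩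
  (∑[ x ∈ allFin n ] 𝟙 (P x) * (∑[ X ∈ allEdges m n ] 𝟙 (allᵛ P X)))  ≡⟨ ∑-*ʳ _ (allFin n) _ ⟩
  #P * (∑[ X ∈ allEdges m n ] 𝟙 (allᵛ P X))                             ≡⟨ cong (#P *_) (∑-𝟙-allᵛ m n P) ⟩
  #P ^ suc m                                                            ∎
  where
  open ≡-Reasoning
  #P = ∑[ x ∈ allFin n ] 𝟙 (P x)

agree-off⇒[]≔-≡ : ∀ {k} {e e′ : Vec A k} t x → (∀ i → i ≢ t → lookup e i ≡ lookup e′ i) →
  e [ t ]≔ x ≡ e′ [ t ]≔ x
agree-off⇒[]≔-≡ {e = e} {e′} t x e≡e′ = begin
  e [ t ]≔ x                           ≡⟨ tabulate∘lookup (e [ t ]≔ x) ⟨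
  Vec.tabulate (lookup (e [ t ]≔ x))   ≡⟨ tabulate-cong pointwise ⟩
  Vec.tabulate (lookup (e′ [ t ]≔ x))  ≡⟨ tabulate∘lookup (e′ [ t ]≔ x) ⟩
  e′ [ t ]≔ x                          ∎
  where
  open ≡-Reasoning
  pointwise : ∀ i → lookup (e [ t ]≔ x) i ≡ lookup (e′ [ t ]≔ x) i
  pointwise i with i Fin.≟ t
  ... | yes refl = trans (lookup∘update i e x) (sym (lookup∘update i e′ x))
  ... | no i≢t   = trans (lookup∘update′ i≢t e x) (trans (e≡e′ i i≢t) (sym (lookup∘update′ i≢t e′ x)))

^-distribʳ-* : ∀ x y m → (x * y) ^ m ≡ x ^ m * y ^ m
^-distribʳ-* x y zero    = refl
^-distribʳ-* x y (suc m) = trans (cong ((x * y) *_) (^-distribʳ-* x y m)) (interchange x y (x ^ m) (y ^ m))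
  where
  interchange : ∀ a b c d → a * b * (c * d) ≡ a * c * (b * d)
  interchange = solve-∀

n<2^n : ∀ n → n < 2 ^ n
n<2^n zero    = s≤s z≤n
n<2^n (suc n) = begin-strict
  suc n          ≤⟨ n<2^n n ⟩
  2 ^ n          <⟨ m<m+n (2 ^ n) (m^n>0 2 n) ⟩
  2 ^ n + 2 ^ n  ≡⟨ cong (2 ^ n +_) (+-identityʳ (2 ^ n)) ⟨
  2 ^ suc n      ∎
  where open ≤-Reasoning

-- In the applications p = a / b, E = |E(G)|, K = n ^ k, S = ∑_X |E(G_X)|, B counts the bad
-- samples X, N = n ^ m, and x, y, a₁, b₁ stand for b ^ M, a ^ M, a ^ (m + 1), b ^ (m + 1).

averaging-lower-bound : ∀ {n K E S a b} m .{{_ : NonZero n}} .{{_ : NonZero K}} →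
  a * K ≤ b * E → (n * E) ^ suc m ≤ K ^ m * (n * S) → n ^ m * (a ^ suc m * K) ≤ b ^ suc m * S
averaging-lower-bound {n} {K} {E} {S} {a} {b} m aK≤bE nE≤KnS =
  *-cancelˡ-≤ (K ^ m * n) {{m*n≢0 (K ^ m) n {{m^n≢0 K m}}}} (begin
    K ^ m * n * (n ^ m * (a ^ suc m * K))  ≡⟨ e₁ n (n ^ m) (a ^ suc m) K (K ^ m) ⟩
    n ^ suc m * (a ^ suc m * K ^ suc m)    ≡⟨ cong (n ^ suc m *_) (^-distribʳ-* a K (suc m)) ⟨
    n ^ suc m * (a * K) ^ suc m            ≡⟨ ^-distribʳ-* n (a * K) (suc m) ⟨
    (n * (a * K)) ^ suc m                  ≤⟨ ^-monoˡ-≤ (suc m) (*-monoʳ-≤ n aK≤bE) ⟩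
    (n * (b * E)) ^ suc m                  ≡⟨ cong (_^ suc m) (x*[y*z]≡y*[x*z] n b E) ⟩
    (b * (n * E)) ^ suc m                  ≡⟨ ^-distribʳ-* b (n * E) (suc m) ⟩
    b ^ suc m * (n * E) ^ suc m            ≤⟨ *-monoʳ-≤ (b ^ suc m) nE≤KnS ⟩
    b ^ suc m * (K ^ m * (n * S))          ≡⟨ e₂ (b ^ suc m) (K ^ m) n S ⟩
    K ^ m * n * (b ^ suc m * S)            ∎)
  where
  open ≤-Reasoning
  e₁ : ∀ n nᵐ A K Kᵐ → Kᵐ * n * (nᵐ * (A * K)) ≡ n * nᵐ * (A * (K * Kᵐ))
  e₁ = solve-∀
  x*[y*z]≡y*[x*z] : ∀ x y z → x * (y * z) ≡ y * (x * z)
  x*[y*z]≡y*[x*z] = solve-∀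
  e₂ : ∀ B Kᵐ n S → B * (Kᵐ * (n * S)) ≡ Kᵐ * n * (B * S)
  e₂ = solve-∀

averaging-upper-bound : ∀ {n K S B x y N} .{{_ : NonZero n}} →
  x * S ≤ x * K * B + N * (y * K) → n * B ≤ N → x ≤ y * n → x * S ≤ 2 * (N * (y * K))
averaging-upper-bound {n} {K} {S} {B} {x} {y} {N} xS≤ nB≤N x≤yn = *-cancelˡ-≤ n (begin
  n * (x * S)                          ≤⟨ *-monoʳ-≤ n xS≤ ⟩
  n * (x * K * B + N * (y * K))        ≡⟨ e₁ n x K B N y ⟩
  x * K * (n * B) + n * (N * (y * K))  ≤⟨ +-monoˡ-≤ _ (*-monoʳ-≤ (x * K) nB≤N) ⟩
  x * K * N + n * (N * (y * K))        ≤⟨ +-monoˡ-≤ _ (*-monoˡ-≤ N (*-monoˡ-≤ K x≤yn)) ⟩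
  y * n * K * N + n * (N * (y * K))    ≡⟨ e₂ n K N y ⟩
  n * (2 * (N * (y * K)))              ∎)
  where
  open ≤-Reasoning
  e₁ : ∀ n x K B N y → n * (x * K * B + N * (y * K)) ≡ x * K * (n * B) + n * (N * (y * K))
  e₁ = solve-∀
  e₂ : ∀ n K N y → y * n * K * N + n * (N * (y * K)) ≡ n * (2 * (N * (y * K)))
  e₂ = solve-∀

ratio-bound : ∀ {N K S a₁ b₁ x y} .{{_ : NonZero N}} .{{_ : NonZero K}} →
  N * (a₁ * K) ≤ b₁ * S → x * S ≤ 2 * (N * (y * K)) → x * a₁ ≤ 2 * (b₁ * y)
ratio-bound {N} {K} {S} {a₁} {b₁} {x} {y} lower upper = *-cancelʳ-≤ _ _ (N * K) {{m*n≢0 N K}} (begin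
  x * a₁ * (N * K)          ≡⟨ e₁ x a₁ N K ⟩
  x * (N * (a₁ * K))        ≤⟨ *-monoʳ-≤ x lower ⟩
  x * (b₁ * S)              ≡⟨ x*[y*z]≡y*[x*z] x b₁ S ⟩
  b₁ * (x * S)              ≤⟨ *-monoʳ-≤ b₁ upper ⟩
  b₁ * (2 * (N * (y * K)))  ≡⟨ e₂ b₁ N y K ⟩
  2 * (b₁ * y) * (N * K)    ∎)
  where
  open ≤-Reasoning
  e₁ : ∀ x a₁ N K → x * a₁ * (N * K) ≡ x * (N * (a₁ * K))
  e₁ = solve-∀
  x*[y*z]≡y*[x*z] : ∀ x y z → x * (y * z) ≡ y * (x * z)
  x*[y*z]≡y*[x*z] = solve-∀
  e₂ : ∀ b₁ N y K → b₁ * (2 * (N * (y * K))) ≡ 2 * (b₁ * y) * (N * K)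
  e₂ = solve-∀

2*a^j<b^j : ∀ {a b} j .{{_ : NonZero a}} → 2 * a < b → 2 * a ^ suc j < b ^ suc j
2*a^j<b^j {a} {b} j 2a<b = begin-strict
  2 * (a * a ^ j)  ≡⟨ *-assoc 2 a (a ^ j) ⟨
  2 * a * a ^ j    <⟨ *-monoˡ-< (a ^ j) {{m^n≢0 a j}} 2a<b ⟩
  b * a ^ j        ≤⟨ *-monoʳ-≤ b (^-monoˡ-≤ j (≤-trans (m≤n*m a 2) (<⇒≤ 2a<b))) ⟩
  b * b ^ j        ∎
  where open ≤-Reasoning

¬ratio-bound : ∀ {a b} m d .{{_ : NonZero a}} → 2 ≤ d → 2 * a < b →
  ¬ (b ^ (m + d) * a ^ suc m ≤ 2 * (b ^ suc m * a ^ (m + d)))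
¬ratio-bound {a} {b} m (suc (suc j)) (s≤s (s≤s _)) 2a<b ratio =
  <⇒≱ (2*a^j<b^j j 2a<b) (*-cancelˡ-≤ (b ^ suc m * a ^ suc m) {{m*n≢0 _ _ {{bᵐ⁺¹≢0}} {{m^n≢0 a (suc m)}}}} (begin
    b ^ suc m * a ^ suc m * b ^ suc j          ≡⟨ x*y*z≡x*z*y (b ^ suc m) (a ^ suc m) (b ^ suc j) ⟩
    b ^ suc m * b ^ suc j * a ^ suc m          ≡⟨ cong (_* a ^ suc m) (split b) ⟨
    b ^ (m + suc (suc j)) * a ^ suc m          ≤⟨ ratio ⟩
    2 * (b ^ suc m * a ^ (m + suc (suc j)))    ≡⟨ cong (λ z → 2 * (b ^ suc m * z)) (split a) ⟩
    2 * (b ^ suc m * (a ^ suc m * a ^ suc j))  ≡⟨ e (b ^ suc m) (a ^ suc m) (a ^ suc j) ⟩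
    b ^ suc m * a ^ suc m * (2 * a ^ suc j)    ∎))
  where
  open ≤-Reasoning
  bᵐ⁺¹≢0 : NonZero (b ^ suc m)
  bᵐ⁺¹≢0 = m^n≢0 b (suc m) {{>-nonZero (m<n⇒0<n 2a<b)}}
  split : ∀ z → z ^ (m + suc (suc j)) ≡ z ^ suc m * z ^ suc j
  split z = trans (cong (z ^_) (+-suc m (suc j))) (^-distribˡ-+-* z (suc m) (suc j))
  x*y*z≡x*z*y : ∀ x y z → x * y * z ≡ x * z * y
  x*y*z≡x*z*y = solve-∀
  e : ∀ x y z → 2 * (x * (y * z)) ≡ x * y * (2 * z)
  e = solve-∀

2^M≤n : ∀ {a b n} M .{{_ : NonZero a}} → 2 * a < b → b ^ M ≤ a ^ M * n → 2 ^ M ≤ n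
2^M≤n {a} {b} {n} M 2a<b bᴹ≤aᴹn = *-cancelˡ-≤ (a ^ M) {{m^n≢0 a M}} (begin
  a ^ M * 2 ^ M  ≡⟨ ^-distribʳ-* a 2 M ⟨
  (a * 2) ^ M    ≤⟨ ^-monoˡ-≤ M (≤-trans (≤-reflexive (*-comm a 2)) (<⇒≤ 2a<b)) ⟩
  b ^ M          ≤⟨ bᴹ≤aᴹn ⟩
  a ^ M * n      ∎)
  where open ≤-Reasoning

module Fraction where

  open import Data.Integer as ℤ using (+_; -[1+_]; +≤+)
  import Data.Integer.Properties as ℤ
  import Data.Integer.Tactic.RingSolver as ℤ
  open import Data.Rational as ℚ using (mkℚ; toℚᵘ)
  import Data.Rational.Properties as ℚ
  open import Data.Rational.Unnormalised as ℚᵘ using (ℚᵘ; mkℚᵘ; ↥_; ↧_; ↧ₙ_; *≡*; *≤*; *<*)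
  import Data.Rational.Unnormalised.Properties as ℚᵘ

  -- Cross-multiplied, so no proof of v ≢ 0 is carried around; hence x ≐ 0 / 0 holds for every x.
  record _≐_/_ (x : ℚᵘ) (u v : ℕ) : Set where
    constructor cross
    field cross-eq : ↥ x ℤ.* + v ≡ + u ℤ.* ↧ x

  ≐-resp-≃ : ∀ {x y u v} → x ℚᵘ.≃ y → x ≐ u / v → y ≐ u / v
  ≐-resp-≃ {x} {y} {u} {v} (*≡* x≃y) (cross x≐u/v) = cross (ℤ.*-cancelʳ-≡ _ _ (↧ x) (begin
    (↥ y ℤ.* + v) ℤ.* ↧ x  ≡⟨ swap₂₃ (↥ y) (+ v) (↧ x) ⟩
    (↥ y ℤ.* ↧ x) ℤ.* + v  ≡⟨ cong (ℤ._* + v) x≃y ⟨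
    (↥ x ℤ.* ↧ y) ℤ.* + v  ≡⟨ swap₂₃ (↥ x) (↧ y) (+ v) ⟩
    (↥ x ℤ.* + v) ℤ.* ↧ y  ≡⟨ cong (ℤ._* ↧ y) x≐u/v ⟩
    (+ u ℤ.* ↧ x) ℤ.* ↧ y  ≡⟨ swap₂₃ (+ u) (↧ x) (↧ y) ⟩
    (+ u ℤ.* ↧ y) ℤ.* ↧ x  ∎))
    where
    open ≡-Reasoning
    swap₂₃ : ∀ a b c → (a ℤ.* b) ℤ.* c ≡ (a ℤ.* c) ℤ.* b
    swap₂₃ = ℤ.solve-∀

  ≐-* : ∀ {x y u v u′ v′} → x ≐ u / v → y ≐ u′ / v′ → (x ℚᵘ.* y) ≐ (u * u′) / (v * v′)
  ≐-* {x@record{}} {y@record{}} {u} {v} {u′} {v′} (cross x≐u/v) (cross y≐u′/v′) = cross (begin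
    (↥ x ℤ.* ↥ y) ℤ.* + (v * v′)      ≡⟨ cong ((↥ x ℤ.* ↥ y) ℤ.*_) (ℤ.pos-* v v′) ⟩
    (↥ x ℤ.* ↥ y) ℤ.* (+ v ℤ.* + v′)  ≡⟨ interchange (↥ x) (↥ y) (+ v) (+ v′) ⟩
    (↥ x ℤ.* + v) ℤ.* (↥ y ℤ.* + v′)  ≡⟨ cong₂ ℤ._*_ x≐u/v y≐u′/v′ ⟩
    (+ u ℤ.* ↧ x) ℤ.* (+ u′ ℤ.* ↧ y)  ≡⟨ interchange (+ u) (↧ x) (+ u′) (↧ y) ⟩
    (+ u ℤ.* + u′) ℤ.* (↧ x ℤ.* ↧ y)  ≡⟨ cong₂ ℤ._*_ (ℤ.pos-* u u′) (ℤ.pos-* (↧ₙ x) (↧ₙ y)) ⟨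
    + (u * u′) ℤ.* + (↧ₙ x * ↧ₙ y)    ∎)
    where
    open ≡-Reasoning
    interchange : ∀ a b c d → (a ℤ.* b) ℤ.* (c ℤ.* d) ≡ (a ℤ.* c) ℤ.* (b ℤ.* d)
    interchange = ℤ.solve-∀

  cross-scale : ∀ {x y u v u′ v′} → x ≐ u / v → y ≐ u′ / v′ →
    (↥ x ℤ.* ↧ y) ℤ.* + (v * v′) ≡ + (u * v′) ℤ.* (↧ x ℤ.* ↧ y)
  cross-scale {x} {y} {u} {v} {u′} {v′} (cross x≐u/v) _ = begin
    (↥ x ℤ.* ↧ y) ℤ.* + (v * v′)      ≡⟨ cong ((↥ x ℤ.* ↧ y) ℤ.*_) (ℤ.pos-* v v′) ⟩
    (↥ x ℤ.* ↧ y) ℤ.* (+ v ℤ.* + v′)  ≡⟨ interchange (↥ x) (↧ y) (+ v) (+ v′) ⟩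
    (↥ x ℤ.* + v) ℤ.* (↧ y ℤ.* + v′)  ≡⟨ cong (ℤ._* (↧ y ℤ.* + v′)) x≐u/v ⟩
    (+ u ℤ.* ↧ x) ℤ.* (↧ y ℤ.* + v′)  ≡⟨ regroup (+ u) (↧ x) (↧ y) (+ v′) ⟩
    (+ u ℤ.* + v′) ℤ.* (↧ x ℤ.* ↧ y)  ≡⟨ cong (ℤ._* (↧ x ℤ.* ↧ y)) (ℤ.pos-* u v′) ⟨
    + (u * v′) ℤ.* (↧ x ℤ.* ↧ y)      ∎
    where
    open ≡-Reasoning
    interchange : ∀ a b c d → (a ℤ.* b) ℤ.* (c ℤ.* d) ≡ (a ℤ.* c) ℤ.* (b ℤ.* d)
    interchange = ℤ.solve-∀
    regroup : ∀ a b c d → (a ℤ.* b) ℤ.* (c ℤ.* d) ≡ (a ℤ.* d) ℤ.* (b ℤ.* c)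
    regroup = ℤ.solve-∀

  cross-scaleʳ : ∀ {x y u v u′ v′} → x ≐ u / v → y ≐ u′ / v′ →
    (↥ y ℤ.* ↧ x) ℤ.* + (v * v′) ≡ + (u′ * v) ℤ.* (↧ x ℤ.* ↧ y)
  cross-scaleʳ {x} {y} {u} {v} {u′} {v′} x≐u/v y≐u′/v′ =
    trans (cong (λ w → (↥ y ℤ.* ↧ x) ℤ.* + w) (*-comm v v′))
          (trans (cross-scale y≐u′/v′ x≐u/v) (cong (+ (u′ * v) ℤ.*_) (ℤ.*-comm (↧ y) (↧ x))))

  ≤⇔cross : ∀ {x y u v u′ v′} → x ≐ u / v → y ≐ u′ / v′ → 1 ≤ v → 1 ≤ v′ → x ℚᵘ.≤ y ⇔ u * v′ ≤ u′ * v
  ≤⇔cross {x@record{}} {y@record{}} {u} {v} {u′} {v′} x≐u/v y≐u′/v′ 1≤v 1≤v′ = mk⇔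
    (λ { (*≤* x≤y) → ℤ.drop‿+≤+ (ℤ.*-cancelʳ-≤-pos _ _ (↧ x ℤ.* ↧ y)
           (subst₂ ℤ._≤_ (cross-scale x≐u/v y≐u′/v′) (cross-scaleʳ x≐u/v y≐u′/v′)
              (ℤ.*-monoʳ-≤-nonNeg (+ (v * v′)) x≤y))) })
    (λ uv′≤u′v → *≤* (ℤ.*-cancelʳ-≤-pos _ _ (+ (v * v′)) {{vv′-positive}}
           (subst₂ ℤ._≤_ (sym (cross-scale x≐u/v y≐u′/v′)) (sym (cross-scaleʳ x≐u/v y≐u′/v′))
              (ℤ.*-monoʳ-≤-nonNeg (↧ x ℤ.* ↧ y) (+≤+ uv′≤u′v)))))
    where
    vv′-positive : ℤ.Positive (+ (v * v′))
    vv′-positive = ℤ.positive (ℤ.+<+ (*-mono-≤ 1≤v 1≤v′))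

  <⇒cross : ∀ {x y u v u′ v′} → x ≐ u / v → y ≐ u′ / v′ → 1 ≤ v → 1 ≤ v′ → x ℚᵘ.< y → u * v′ < u′ * v
  <⇒cross {x@record{}} {y@record{}} {u} {v} {u′} {v′} x≐u/v y≐u′/v′ 1≤v 1≤v′ (*<* x<y) =
    ℤ.drop‿+<+ (ℤ.*-cancelʳ-<-nonNeg (↧ x ℤ.* ↧ y)
      (subst₂ ℤ._<_ (cross-scale x≐u/v y≐u′/v′) (cross-scaleʳ x≐u/v y≐u′/v′)
        (ℤ.*-monoʳ-<-pos (+ (v * v′)) {{ℤ.positive (ℤ.+<+ (*-mono-≤ 1≤v 1≤v′))}} x<y)))

  ℕ→ℚ-≐ : ∀ c → toℚᵘ (ℕ→ℚ c) ≐ c / 1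
  ℕ→ℚ-≐ c = ≐-resp-≃ (ℚᵘ.≃-sym (ℚ.toℚᵘ-fromℚᵘ (mkℚᵘ (+ c) 0))) (cross refl)

  ≐-*ℚ : ∀ {p q u v u′ v′} → toℚᵘ p ≐ u / v → toℚᵘ q ≐ u′ / v′ → toℚᵘ (p *ℚ q) ≐ (u * u′) / (v * v′)
  ≐-*ℚ {p} {q} p≐ q≐ = ≐-resp-≃ (ℚᵘ.≃-sym (ℚ.toℚᵘ-homo-* p q)) (≐-* p≐ q≐)

  ≐-*ℕ→ℚ : ∀ {p u v} c → toℚᵘ p ≐ u / v → toℚᵘ (p *ℚ ℕ→ℚ c) ≐ (u * c) / v
  ≐-*ℕ→ℚ {v = v} c p≐u/v = subst (λ w → toℚᵘ _ ≐ _ / w) (*-identityʳ v) (≐-*ℚ p≐u/v (ℕ→ℚ-≐ c))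

  ≐-^ℚ : ∀ {p u v} M → toℚᵘ p ≐ u / v → toℚᵘ (p ^ℚ M) ≐ (u ^ M) / (v ^ M)
  ≐-^ℚ zero    p≐ = ℕ→ℚ-≐ 1
  ≐-^ℚ (suc M) p≐ = ≐-*ℚ p≐ (≐-^ℚ M p≐)

  ≤ℚ⇔cross : ∀ {p q u v u′ v′} → toℚᵘ p ≐ u / v → toℚᵘ q ≐ u′ / v′ → 1 ≤ v → 1 ≤ v′ →
    p ≤ℚ q ⇔ u * v′ ≤ u′ * v
  ≤ℚ⇔cross p≐ q≐ 1≤v 1≤v′ = mk⇔ (to ∘ ℚ.toℚᵘ-mono-≤) (ℚ.toℚᵘ-cancel-≤ ∘ from)
    where open Equivalence (≤⇔cross p≐ q≐ 1≤v 1≤v′)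

  <ℚ⇒cross : ∀ {p q u v u′ v′} → toℚᵘ p ≐ u / v → toℚᵘ q ≐ u′ / v′ → 1 ≤ v → 1 ≤ v′ →
    p <ℚ q → u * v′ < u′ * v
  <ℚ⇒cross p≐ q≐ 1≤v 1≤v′ = <⇒cross p≐ q≐ 1≤v 1≤v′ ∘ ℚ.toℚᵘ-mono-<

  positive⇒fraction : ∀ p → 0ℚ <ℚ p → ∃ λ a → ∃ λ b → 1 ≤ a × 1 ≤ b × toℚᵘ p ≐ a / b
  positive⇒fraction (mkℚ (+ a) b-1 _) 0<p = a , suc b-1 , 1≤a , s≤s z≤n , p≐a/b
    where
    p≐a/b : mkℚᵘ (+ a) b-1 ≐ a / suc b-1
    p≐a/b = cross refl
    1≤a : 1 ≤ a
    1≤a = ≤-trans (<ℚ⇒cross (ℕ→ℚ-≐ 0) p≐a/b (s≤s z≤n) (s≤s z≤n) 0<p) (≤-reflexive (*-identityʳ a))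
  positive⇒fraction (mkℚ -[1+ _ ] _ _) (ℚ.*<* ())

  1≤ℚ⇔ : ∀ {p u v} → toℚᵘ p ≐ u / v → 1 ≤ v → 1ℚ ≤ℚ p ⇔ v ≤ u
  1≤ℚ⇔ {u = u} {v} p≐u/v 1≤v = mk⇔
    (λ 1≤p → subst₂ _≤_ (+-identityʳ v) (*-identityʳ u) (to 1≤p))
    (λ v≤u → from (subst₂ _≤_ (sym (+-identityʳ v)) (sym (*-identityʳ u)) v≤u))
    where open Equivalence (≤ℚ⇔cross (ℕ→ℚ-≐ 1) p≐u/v (s≤s z≤n) 1≤v)

  ≤ℚℕ→ℚ⇔ : ∀ {p u v} c → toℚᵘ p ≐ u / v → 1 ≤ v → p ≤ℚ ℕ→ℚ c ⇔ u ≤ v * c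
  ≤ℚℕ→ℚ⇔ {u = u} {v} c p≐u/v 1≤v = mk⇔
    (λ p≤c → subst₂ _≤_ (*-identityʳ u) (*-comm c v) (to p≤c))
    (λ u≤vc → from (subst₂ _≤_ (sym (*-identityʳ u)) (*-comm v c) u≤vc))
    where open Equivalence (≤ℚ⇔cross p≐u/v (ℕ→ℚ-≐ c) 1≤v (s≤s z≤n))

  <ℚ½⇒ : ∀ {p u v} → toℚᵘ p ≐ u / v → 1 ≤ v → p <ℚ ½ → 2 * u < v
  <ℚ½⇒ {u = u} {v} p≐u/v 1≤v p<½ =
    subst₂ _<_ (*-comm u 2) (+-identityʳ v) (<ℚ⇒cross p≐u/v (cross {u = 1} {v = 2} refl) 1≤v (s≤s z≤n) p<½)

open Fraction

-- Restricting G to the edges extended by a sample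

-- MutualExt G S t x unfolds to ∀ e → IsEdge G e → FaceIn t S e → IsEdge G (e [ t ]≔ x).
FaceIn : ∀ {k n} → Fin k → List (Vertex k n) → Edge k n → Set
FaceIn t S e = ∀ i → i ≢ t → (i , lookup e i) ∈ S

module _ {k n : ℕ} (G : Hypergraph k n) (t : Fin k) where

  extendedBy : ∀ {m} → Vec (Fin n) m → Hypergraph k n
  extendedBy X e = G e ∧ allᵛ (λ x → G (e [ t ]≔ x)) X

  extendedBy-⊆ : ∀ {m} (X : Vec (Fin n) m) → extendedBy X ⊆ᴴ G
  extendedBy-⊆ X e Xe = ∧-conicalˡ _ _ Xe

  degree : Edge k n → ℕ
  degree e = ∑[ x ∈ allFin n ] 𝟙 (G (e [ t ]≔ x))

  degree-[]≔ : ∀ e x → degree (e [ t ]≔ x) ≡ degree e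
  degree-[]≔ e x = ∑-cong (allFin n) (λ y → cong (λ e → 𝟙 (G e)) ([]≔-idempotent e t))

  ∑-numEdges-extendedBy : ∀ m →
    (∑[ X ∈ allEdges m n ] numEdges (extendedBy X)) ≡ (∑[ e ∈ allEdges k n ] 𝟙 (G e) * degree e ^ m)
  ∑-numEdges-extendedBy m = begin
    (∑[ X ∈ allEdges m n ] numEdges (extendedBy X))
      ≡⟨ ∑-cong (allEdges m n) (λ X → numEdges-∑ (extendedBy X)) ⟩
    (∑[ X ∈ allEdges m n ] ∑[ e ∈ allEdges k n ] 𝟙 (extendedBy X e))
      ≡⟨ ∑-comm (allEdges m n) (allEdges k n) _ ⟩
    (∑[ e ∈ allEdges k n ] ∑[ X ∈ allEdges m n ] 𝟙 (extendedBy X e))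
      ≡⟨ ∑-cong (allEdges k n) (λ e → ∑-cong (allEdges m n) (λ X → 𝟙-∧ (G e) _)) ⟩
    (∑[ e ∈ allEdges k n ] ∑[ X ∈ allEdges m n ] 𝟙 (G e) * 𝟙 (allᵛ (λ x → G (e [ t ]≔ x)) X))
      ≡⟨ ∑-cong (allEdges k n) (λ e → ∑-*ˡ (𝟙 (G e)) (allEdges m n) _) ⟩
    (∑[ e ∈ allEdges k n ] 𝟙 (G e) * (∑[ X ∈ allEdges m n ] 𝟙 (allᵛ (λ x → G (e [ t ]≔ x)) X)))
      ≡⟨ ∑-cong (allEdges k n) (λ e → cong (𝟙 (G e) *_) (∑-𝟙-allᵛ m n _)) ⟩
    (∑[ e ∈ allEdges k n ] 𝟙 (G e) * degree e ^ m)
      ∎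
    where open ≡-Reasoning

  ∑-degree : ∑ (allEdges k n) degree ≡ n * numEdges G
  ∑-degree = trans (∑-allEdges-[]≔ k n t (λ e → 𝟙 (G e))) (cong (n *_) (sym (numEdges-∑ G)))

  ∑-degree^ : ∀ m → n * (∑[ e ∈ allEdges k n ] 𝟙 (G e) * degree e ^ m) ≡ (∑[ e ∈ allEdges k n ] degree e ^ suc m)
  ∑-degree^ m = begin
    n * (∑[ e ∈ allEdges k n ] 𝟙 (G e) * degree e ^ m)
      ≡⟨ ∑-allEdges-[]≔ k n t _ ⟨
    (∑[ e ∈ allEdges k n ] ∑[ x ∈ allFin n ] 𝟙 (G (e [ t ]≔ x)) * degree (e [ t ]≔ x) ^ m)
      ≡⟨ ∑-cong (allEdges k n) (λ e → ∑-cong (allFin n) (λ x →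
           cong (λ δ → 𝟙 (G (e [ t ]≔ x)) * δ ^ m) (degree-[]≔ e x))) ⟩
    (∑[ e ∈ allEdges k n ] ∑[ x ∈ allFin n ] 𝟙 (G (e [ t ]≔ x)) * degree e ^ m)
      ≡⟨ ∑-cong (allEdges k n) (λ e → ∑-*ʳ (degree e ^ m) (allFin n) _) ⟩
    (∑[ e ∈ allEdges k n ] degree e ^ suc m)
      ∎
    where open ≡-Reasoning

  extendedBy-average : ∀ m →
    (n * numEdges G) ^ suc m ≤ (n ^ k) ^ m * (n * (∑[ X ∈ allEdges m n ] numEdges (extendedBy X)))
  extendedBy-average m = begin
    (n * numEdges G) ^ suc m                                               ≡⟨ cong (_^ suc m) ∑-degree ⟨
    ∑ (allEdges k n) degree ^ suc m                                        ≤⟨ power-mean-∑ (allEdges k n) degree m ⟩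
    length (allEdges k n) ^ m * (∑[ e ∈ allEdges k n ] degree e ^ suc m)
      ≡⟨ cong₂ (λ N S → N ^ m * S) (length-allEdges k n)
               (sym (trans (cong (n *_) (∑-numEdges-extendedBy m)) (∑-degree^ m))) ⟩
    (n ^ k) ^ m * (n * (∑[ X ∈ allEdges m n ] numEdges (extendedBy X)))
      ∎
    where open ≤-Reasoning

  extendedBy-mutualExt : ∀ {m S r y} (X : Vec (Fin n) m) → r ≢ t →
    MutualExt G (S ++ map (λ j → t , lookup X j) (allFin m)) r y → MutualExt (extendedBy X) S r y
  extendedBy-mutualExt {m} {S} {r} {y} X r≢t ext e Xe S∋face =
    cong₂ _∧_ (ext e (∧-conicalˡ _ _ Xe) (λ i i≢r → ∈-++⁺ˡ (S∋face i i≢r))) (allᵛ-tabulate X extends-X)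
    where
    XL = map (λ j → t , lookup X j) (allFin m)
    face-[t]≔ : ∀ j → FaceIn r (S ++ XL) (e [ t ]≔ lookup X j)
    face-[t]≔ j i i≢r with i Fin.≟ t
    ... | yes refl = subst (λ x → (t , x) ∈ S ++ XL) (sym (lookup∘update t e (lookup X j)))
                       (∈-++⁺ʳ S (∈-map⁺ (λ j → t , lookup X j) (∈-allFin j)))
    ... | no i≢t   = subst (λ x → (i , x) ∈ S ++ XL) (sym (lookup∘update′ i≢t e (lookup X j)))
                       (∈-++⁺ˡ (S∋face i i≢r))
    extends-X : ∀ j → G ((e [ r ]≔ y) [ t ]≔ lookup X j) ≡ true
    extends-X j = subst (λ e → G e ≡ true) ([]≔-commutes e t r (r≢t ∘ sym))
                    (ext (e [ t ]≔ lookup X j) (allᵛ-lookup X (∧-conicalʳ _ _ Xe) j) (face-[t]≔ j))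

  extendedBy-extending : ∀ {m h d D r} (X : Vec (Fin n) m) → r ≢ t → d + m ≤ D →
    VertexExtending G h D r → VertexExtending (extendedBy X) h d r
  extendedBy-extending {m} {d = d} {D} {r} X r≢t d+m≤D ext S |S|≤d S∌r =
    let (f , f-inj , f-ext) = ext (S ++ XL) |S++XL|≤D S++XL∌r
    in f , f-inj , λ j → extendedBy-mutualExt X r≢t (f-ext j)
    where
    XL = map (λ j → t , lookup X j) (allFin m)
    |S++XL|≤D : length (S ++ XL) ≤ D
    |S++XL|≤D = begin
      length (S ++ XL)      ≡⟨ length-++ S ⟩
      length S + length XL  ≡⟨ cong (length S +_) (trans (length-map _ (allFin m)) (length-allFin m)) ⟩
      length S + m          ≤⟨ +-monoˡ-≤ m |S|≤d ⟩
      d + m                 ≤⟨ d+m≤D ⟩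
      D                     ∎
      where open ≤-Reasoning
    S++XL∌r : ∀ v → v ∈ S ++ XL → proj₁ v ≢ r
    S++XL∌r v v∈ with ∈-++⁻ S v∈
    ... | inj₁ v∈S  = S∌r v v∈S
    ... | inj₂ v∈XL with ∈-map⁻ _ v∈XL
    ...   | j , _ , refl = r≢t ∘ sym

_≟ᵛ_ : ∀ {k n} → DecidableEquality (Vertex k n)
_≟ᵛ_ = ≡-dec Fin._≟_ Fin._≟_

allVertices : ∀ k n → List (Vertex k n)
allVertices k n = cartesianProduct (allFin k) (allFin n)

length-allVertices : ∀ k n → length (allVertices k n) ≡ k * n
length-allVertices k n =
  trans (length-cartesianProduct (allFin k) (allFin n)) (cong₂ _*_ (length-allFin k) (length-allFin n))

∈-allVertices : ∀ {k n} (v : Vertex k n) → v ∈ allVertices k n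
∈-allVertices (i , x) = ∈-cartesianProduct⁺ (∈-allFin i) (∈-allFin x)

module _ {k′ n : ℕ} (t : Fin (suc k′)) where

  private
    k = suc k′

  faceVertex : Edge k n → Fin k′ → Vertex k n
  faceVertex e j = punchIn t j , lookup e (punchIn t j)

  faceVertex-injective : ∀ e → Injective _≡_ _≡_ (faceVertex e)
  faceVertex-injective e eq = punchIn-injective t _ _ (cong proj₁ eq)

  face : Edge k n → List (Vertex k n)
  face e = map (faceVertex e) (allFin k′)

  length-face : ∀ e → length (face e) ≡ k′
  length-face e = trans (length-map (faceVertex e) (allFin k′)) (length-allFin k′)

  FaceIn⇒face⊆ : ∀ {S} e → FaceIn t S e → face e ⊆ S
  FaceIn⇒face⊆ e S∋face v∈ with ∈-map⁻ (faceVertex e) v∈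
  ... | j , _ , refl = S∋face (punchIn t j) (punchInᵢ≢i t j)

  face⊆⇒FaceIn : ∀ {S} e → face e ⊆ S → FaceIn t S e
  face⊆⇒FaceIn {S} e face⊆S i i≢t =
    subst (λ i → (i , lookup e i) ∈ S) (punchIn-punchOut t≢i)
          (face⊆S (∈-map⁺ (faceVertex e) (∈-allFin (punchOut t≢i))))
    where
    t≢i = i≢t ∘ sym

  FaceIn⇒k′≤length : ∀ {S} e → FaceIn t S e → k′ ≤ length S
  FaceIn⇒k′≤length e S∋face =
    injective-∈⇒≤length (faceVertex e) (faceVertex-injective e) (λ j → FaceIn⇒face⊆ e S∋face (∈-map⁺ _ (∈-allFin j)))

  FaceIn-unique : ∀ {τ} e e′ x → length τ ≡ k′ → FaceIn t τ e → FaceIn t τ e′ → e [ t ]≔ x ≡ e′ [ t ]≔ x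
  FaceIn-unique {τ} e e′ x |τ|≡k′ τ∋e τ∋e′ = agree-off⇒[]≔-≡ t x agree
    where
    agree : ∀ i → i ≢ t → lookup e i ≡ lookup e′ i
    agree i i≢t with lookup e i Fin.≟ lookup e′ i
    ... | yes eᵢ≡e′ᵢ = eᵢ≡e′ᵢ
    ... | no eᵢ≢e′ᵢ  = contradiction (subst (k ≤_) |τ|≡k′ (injective-∈⇒≤length w w-injective w∈τ)) (<-irrefl refl)
      where
      -- (i , e′ᵢ) and the k - 1 vertices of e outside part t are k distinct vertices of τ.
      w : Fin k → Vertex k n
      w zero    = i , lookup e′ i
      w (suc j) = faceVertex e j
      w-injective : Injective _≡_ _≡_ w
      w-injective {zero}   {zero}   _  = refl
      w-injective {zero}   {suc j}  eq with cong proj₁ eq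
      ... | refl = contradiction (sym (cong proj₂ eq)) eᵢ≢e′ᵢ
      w-injective {suc j}  {zero}   eq with cong proj₁ eq
      ... | refl = contradiction (cong proj₂ eq) eᵢ≢e′ᵢ
      w-injective {suc j₁} {suc j₂} eq = cong suc (faceVertex-injective e eq)
      w∈τ : ∀ j → w j ∈ τ
      w∈τ zero    = τ∋e′ i i≢t
      w∈τ (suc j) = FaceIn⇒face⊆ e τ∋e (∈-map⁺ (faceVertex e) (∈-allFin j))

  FaceIn? : ∀ (S : List (Vertex k n)) e → Dec (FaceIn t S e)
  FaceIn? S e = Fin.all? (λ i → ¬? (i Fin.≟ t) →-dec DecMembership._∈?_ _≟ᵛ_ (i , lookup e i) S)

  MutualExt? : ∀ (G : Hypergraph k n) S x → Dec (MutualExt G S t x)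
  MutualExt? G S x = ∀-Vec? (λ e → (G e Bool.≟ true) →-dec (FaceIn? S e →-dec (G (e [ t ]≔ x) Bool.≟ true)))

-- Dependent random choice

module _ {k′ n : ℕ} (G : Hypergraph (suc k′) n) (t : Fin (suc k′)) (d h : ℕ) where

  private
    k = suc k′

  families : List (List (List (Vertex k n)))
  families = concatMap (λ σ → sublists (choose σ k′)) (choose (allVertices k n) d)

  length-families : length families ≡ ((k * n) C d) * 2 ^ (d C k′)
  length-families = begin
    length families                                                ≡⟨ length-concatMap _ (choose (allVertices k n) d) ⟩
    (∑[ σ ∈ choose (allVertices k n) d ] length (sublists (choose σ k′)))
      ≡⟨ ∑-cong-∈ (choose (allVertices k n) d) (λ {σ} σ∈ → begin
           length (sublists (choose σ k′))  ≡⟨ length-sublists (choose σ k′) ⟩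
           2 ^ length (choose σ k′)
             ≡⟨ cong (2 ^_) (trans (length-choose σ k′) (cong (_C k′) (length-∈-choose _ d σ∈))) ⟩
           2 ^ (d C k′)                     ∎) ⟩
    (∑[ σ ∈ choose (allVertices k n) d ] 2 ^ (d C k′))             ≡⟨ ∑-const (choose (allVertices k n) d) _ ⟩
    length (choose (allVertices k n) d) * 2 ^ (d C k′)
      ≡⟨ cong (_* 2 ^ (d C k′)) (trans (length-choose (allVertices k n) d) (cong (_C d) (length-allVertices k n))) ⟩
    ((k * n) C d) * 2 ^ (d C k′)                                   ∎
    where open ≡-Reasoning

  CommonExt : List (List (Vertex k n)) → Fin n → Set
  CommonExt F x = All (λ τ → MutualExt G τ t x) F

  CommonExt? : ∀ F x → Dec (CommonExt F x)
  CommonExt? F x = All.all? (λ τ → MutualExt? t G τ x) F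

  commonExt : List (List (Vertex k n)) → Fin n → Bool
  commonExt F x = does (CommonExt? F x)

  #commonExt : List (List (Vertex k n)) → ℕ
  #commonExt F = ∑[ x ∈ allFin n ] 𝟙 (commonExt F x)

  bad : ∀ {m} → Vec (Fin n) m → Bool
  bad X = any (λ F → (#commonExt F <ᵇ h) ∧ allᵛ (commonExt F) X) families

  ∑-bad : ∀ m → (∑[ X ∈ allEdges m n ] 𝟙 (bad X)) ≤ length families * h ^ m
  ∑-bad m = begin
    (∑[ X ∈ allEdges m n ] 𝟙 (bad X))
      ≤⟨ ∑-mono (allEdges m n) (λ X → 𝟙-any _ families) ⟩
    (∑[ X ∈ allEdges m n ] ∑[ F ∈ families ] 𝟙 ((#commonExt F <ᵇ h) ∧ allᵛ (commonExt F) X))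
      ≡⟨ ∑-comm (allEdges m n) families _ ⟩
    (∑[ F ∈ families ] ∑[ X ∈ allEdges m n ] 𝟙 ((#commonExt F <ᵇ h) ∧ allᵛ (commonExt F) X))
      ≡⟨ ∑-cong families (λ F → trans (∑-cong (allEdges m n) (λ X → 𝟙-∧ (#commonExt F <ᵇ h) _))
                                      (∑-*ˡ (𝟙 (#commonExt F <ᵇ h)) (allEdges m n) _)) ⟩
    (∑[ F ∈ families ] 𝟙 (#commonExt F <ᵇ h) * (∑[ X ∈ allEdges m n ] 𝟙 (allᵛ (commonExt F) X)))
      ≡⟨ ∑-cong families (λ F → cong (𝟙 (#commonExt F <ᵇ h) *_) (∑-𝟙-allᵛ m n (commonExt F))) ⟩
    (∑[ F ∈ families ] 𝟙 (#commonExt F <ᵇ h) * #commonExt F ^ m)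
      ≤⟨ ∑-≤-length* families (λ F → small⇒^≤ (#commonExt F)) ⟩
    length families * h ^ m
      ∎
    where
    open ≤-Reasoning
    small⇒^≤ : ∀ c → 𝟙 (c <ᵇ h) * c ^ m ≤ h ^ m
    small⇒^≤ c with c <ᵇ h in c<ᵇh
    ... | true  = ≤-trans (≤-reflexive (+-identityʳ _)) (^-monoˡ-≤ m (<⇒≤ (<ᵇ⇒< c h (subst T (sym c<ᵇh) _))))
    ... | false = z≤n

  module _ {m} (X : Vec (Fin n) m) where

    ExtendedByAll? : ∀ τ → Dec (∀ j → MutualExt G τ t (lookup X j))
    ExtendedByAll? τ = Fin.all? (λ j → MutualExt? t G τ (lookup X j))

    extendableSubsets : List (Vertex k n) → List (List (Vertex k n))
    extendableSubsets σ = filter ExtendedByAll? (choose σ k′)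

    extendableSubsets-∈-families : ∀ {σ} → σ ∈ choose (allVertices k n) d → extendableSubsets σ ∈ families
    extendableSubsets-∈-families {σ} σ∈ = ∈-concatMap⁺ (λ σ → sublists (choose σ k′))
      (Any.map (λ { refl → filter-∈-sublists ExtendedByAll? (choose σ k′) }) σ∈)

    X⊆commonExt : ∀ σ j → commonExt (extendableSubsets σ) (lookup X j) ≡ true
    X⊆commonExt σ j = dec-true (CommonExt? (extendableSubsets σ) (lookup X j))
      (All.tabulate (λ τ∈ → proj₂ (∈-filter⁻ ExtendedByAll? {xs = choose σ k′} τ∈) j))

    good⇒h≤#commonExt : ∀ {F} → bad X ≡ false → F ∈ families → (∀ j → commonExt F (lookup X j) ≡ true) →
      h ≤ #commonExt F
    good⇒h≤#commonExt {F} X-good F∈ X⊆F = ≮⇒≥ (λ #F<h → subst T ¬#F<ᵇh (<⇒<ᵇ #F<h))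
      where
      ¬#F<ᵇh : (#commonExt F <ᵇ h) ≡ false
      ¬#F<ᵇh = trans (sym (∧-identityʳ _))
        (subst (λ c → (#commonExt F <ᵇ h) ∧ c ≡ false) (allᵛ-tabulate X X⊆F) (any-≡false _ X-good F∈))

    commonExt⇒mutualExt : ∀ {σ S x} → S ⊆ σ → CommonExt (extendableSubsets σ) x →
      MutualExt (extendedBy G t X) S t x
    commonExt⇒mutualExt {σ} {S} {x} S⊆σ x-ext e Xe S∋face =
      cong₂ _∧_ (All.lookup x-ext τ∈F e (∧-conicalˡ _ _ Xe) τ∋face)
                (allᵛ-tabulate X (λ j → subst (λ e → G e ≡ true) (sym ([]≔-idempotent e t)) (allᵛ-lookup X X-ext j)))
      where
      X-ext : allᵛ (λ y → G (e [ t ]≔ y)) X ≡ true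
      X-ext = ∧-conicalʳ _ _ Xe
      σ∋face : FaceIn t σ e
      σ∋face i i≢t = S⊆σ (S∋face i i≢t)
      τ-choice = ⊆-choose _≟ᵛ_ σ k′ (face t e) (≤-reflexive (length-face t e))
                   (FaceIn⇒k′≤length t e σ∋face) (FaceIn⇒face⊆ t e σ∋face)
      τ = proj₁ τ-choice
      τ∈ = proj₁ (proj₂ τ-choice)
      τ∋face : FaceIn t τ e
      τ∋face = face⊆⇒FaceIn t e (proj₂ (proj₂ τ-choice))
      τ-ext : ∀ j → MutualExt G τ t (lookup X j)
      τ-ext j e′ _ τ∋face′ = subst (λ e → G e ≡ true)
        (FaceIn-unique t e e′ (lookup X j) (length-∈-choose σ k′ τ∈) τ∋face τ∋face′) (allᵛ-lookup X X-ext j)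
      τ∈F : τ ∈ extendableSubsets σ
      τ∈F = ∈-filter⁺ ExtendedByAll? τ∈ τ-ext

    good⇒extending : bad X ≡ false → d ≤ k * n → VertexExtending (extendedBy G t X) h d t
    good⇒extending X-good d≤kn S |S|≤d _ =
      let (f , f-inj , f∈F) = count⇒injection n h (commonExt F) h≤#F
      in f , f-inj , λ j → commonExt⇒mutualExt S⊆σ (does-true⇒ (CommonExt? F (f j)) (f∈F j))
      where
      σ-choice = ⊆-choose _≟ᵛ_ (allVertices k n) d S |S|≤d (≤-trans d≤kn (≤-reflexive (sym (length-allVertices k n))))
                   (λ {v} _ → ∈-allVertices v)
      σ = proj₁ σ-choice
      S⊆σ = proj₂ (proj₂ σ-choice)
      F = extendableSubsets σ
      h≤#F : h ≤ #commonExt F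
      h≤#F = good⇒h≤#commonExt X-good (extendableSubsets-∈-families (proj₁ (proj₂ σ-choice))) (X⊆commonExt σ)

    extendedBy-extending-≤ : ∀ {D} → bad X ≡ false → d ≤ k * n → d + m ≤ D →
      (∀ r → r <ᶠ t → VertexExtending G h D r) → ∀ r → r ≤ᶠ t → VertexExtending (extendedBy G t X) h d r
    extendedBy-extending-≤ X-good d≤kn d+m≤D ext r r≤t with r Fin.≟ t
    ... | yes refl = good⇒extending X-good d≤kn
    ... | no r≢t   = extendedBy-extending G t X r≢t d+m≤D (ext r (Fin.≤∧≢⇒< r≤t r≢t))

    not-good⇒numEdges-≤ : ∀ α β → ¬ (bad X ≡ false × α ≤ β * numEdges (extendedBy G t X)) →
      β * numEdges (extendedBy G t X) ≤ β * n ^ k * 𝟙 (bad X) + α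
    not-good⇒numEdges-≤ α β not-good with bad X
    ... | true  = ≤-trans (*-monoʳ-≤ β (numEdges-≤ (extendedBy G t X)))
                          (≤-trans (≤-reflexive (sym (*-identityʳ _))) (m≤m+n _ α))
    ... | false = ≤-trans (<⇒≤ (≰⇒> (λ α≤ → not-good (refl , α≤)))) (m≤n+m _ _)

  good-sample : ∀ {m M a b} .{{_ : NonZero n}} .{{_ : NonZero a}} → M ≡ m + d → 2 ≤ d → 2 * a < b →
    b ^ M ≤ a ^ M * n → a * n ^ k ≤ b * numEdges G → n * (length families * h ^ m) ≤ n ^ m →
    ∃ λ (X : Vec (Fin n) m) → bad X ≡ false × a ^ M * n ^ k ≤ b ^ M * numEdges (extendedBy G t X)
  good-sample {m} {M} {a} {b} refl 2≤d 2a<b bᴹ≤aᴹn dense few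
    with ∃-Vec? (λ X → (bad X Bool.≟ false) ×-dec (a ^ M * n ^ k ≤? b ^ M * numEdges (extendedBy G t X)))
  ... | yes good = good
  ... | no none  = contradiction
                     (ratio-bound {n ^ m} {n ^ k} {S} {a ^ suc m} {b ^ suc m} {b ^ M} {a ^ M} lower upper)
                     (¬ratio-bound m d 2≤d 2a<b)
    where
    instance
      nᵐ≢0 : NonZero (n ^ m)
      nᵐ≢0 = m^n≢0 n m
      nᵏ≢0 : NonZero (n ^ k)
      nᵏ≢0 = m^n≢0 n k
    S = ∑[ X ∈ allEdges m n ] numEdges (extendedBy G t X)
    #bad = ∑[ X ∈ allEdges m n ] 𝟙 (bad X)
    lower : n ^ m * (a ^ suc m * n ^ k) ≤ b ^ suc m * S
    lower = averaging-lower-bound {n} {n ^ k} {numEdges G} {S} {a} {b} m dense (extendedBy-average G t m)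
    sum-bound : b ^ M * S ≤ b ^ M * n ^ k * #bad + n ^ m * (a ^ M * n ^ k)
    sum-bound = begin
      b ^ M * S
        ≡⟨ ∑-*ˡ (b ^ M) (allEdges m n) _ ⟨
      (∑[ X ∈ allEdges m n ] b ^ M * numEdges (extendedBy G t X))
        ≤⟨ ∑-mono (allEdges m n) (λ X → not-good⇒numEdges-≤ X (a ^ M * n ^ k) (b ^ M) (λ good → none (X , good))) ⟩
      (∑[ X ∈ allEdges m n ] b ^ M * n ^ k * 𝟙 (bad X) + a ^ M * n ^ k)
        ≡⟨ ∑-+ (allEdges m n) _ _ ⟩
      (∑[ X ∈ allEdges m n ] b ^ M * n ^ k * 𝟙 (bad X)) + (∑[ X ∈ allEdges m n ] a ^ M * n ^ k)
        ≡⟨ cong₂ _+_ (∑-*ˡ (b ^ M * n ^ k) (allEdges m n) _)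
                     (trans (∑-const (allEdges m n) _) (cong (_* (a ^ M * n ^ k)) (length-allEdges m n))) ⟩
      b ^ M * n ^ k * #bad + n ^ m * (a ^ M * n ^ k)
        ∎
      where open ≤-Reasoning
    upper : b ^ M * S ≤ 2 * (n ^ m * (a ^ M * n ^ k))
    upper = averaging-upper-bound {n} {n ^ k} {S} {#bad} {b ^ M} {a ^ M} {n ^ m} sum-bound
              (≤-trans (*-monoʳ-≤ n (∑-bad m)) few) bᴹ≤aᴹn

  dependent-random-choice : ∀ {m M a b} .{{_ : NonZero n}} .{{_ : NonZero a}} → M ≡ m + d → 2 ≤ d → 2 * a < b →
    b ^ M ≤ a ^ M * n → a * n ^ k ≤ b * numEdges G → n * h ^ m * ((k * n) C d) * 2 ^ (d C k′) ≤ n ^ m →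
    (∀ r → r <ᶠ t → VertexExtending G h M r) →
    ∃ λ (X : Vec (Fin n) m) → a ^ M * n ^ k ≤ b ^ M * numEdges (extendedBy G t X) ×
                               (∀ r → r ≤ᶠ t → VertexExtending (extendedBy G t X) h d r)
  dependent-random-choice {m} {M} M≡m+d 2≤d 2a<b bᴹ≤aᴹn dense few ext =
    let (X , X-good , X-dense) = good-sample M≡m+d 2≤d 2a<b bᴹ≤aᴹn dense few′
    in X , X-dense , extendedBy-extending-≤ X X-good d≤kn (≤-reflexive (trans (+-comm d m) (sym M≡m+d))) ext
    where
    few′ : n * (length families * h ^ m) ≤ n ^ m
    few′ = subst (λ F → n * (F * h ^ m) ≤ n ^ m) (sym length-families)
                 (≤-trans (≤-reflexive (regroup n (h ^ m) _ _)) few)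
      where
      regroup : ∀ n hᵐ c e → n * (c * e * hᵐ) ≡ n * hᵐ * c * e
      regroup = solve-∀
    d≤kn : d ≤ k * n
    d≤kn = begin
      d      ≤⟨ m≤n+m d m ⟩
      m + d  ≡⟨ M≡m+d ⟨
      M      <⟨ n<2^n M ⟩
      2 ^ M  ≤⟨ 2^M≤n M 2a<b bᴹ≤aᴹn ⟩
      n      ≤⟨ m≤n*m n k ⟩
      k * n  ∎
      where open ≤-Reasoning

lemma2p3 : (d k h n l : ℕ) (t : Fin k) (p : ℚ) →
    2 ≤ d → 3 ≤ k → 1 ≤ h → 1 ≤ n → 1 ≤ l →
    0ℚ <ℚ p → p <ℚ ½ →
    1ℚ ≤ℚ (p ^ℚ ((l + 1) * d)) *ℚ ℕ→ℚ n →
    n * h ^ (l * d) * ((k * n) C d) * 2 ^ (d C (k ∸ 1)) ≤ n ^ (l * d) →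
    (G : Hypergraph k n) →
    p *ℚ ℕ→ℚ (n ^ k) ≤ℚ ℕ→ℚ (numEdges G) →
    (∀ r → r <ᶠ t → VertexExtending G h ((l + 1) * d) r) →
    ∃ λ (G' : Hypergraph k n) →
      (G' ⊆ᴴ G) ×
      ((p ^ℚ ((l + 1) * d)) *ℚ ℕ→ℚ (n ^ k) ≤ℚ ℕ→ℚ (numEdges G')) ×
      (∀ r → r ≤ᶠ t → VertexExtending G' h d r)
lemma2p3 d zero     h n l ()
lemma2p3 d (suc k′) h n l t p 2≤d _ _ 1≤n _ 0<p p<½ 1≤pᴹn few G dense ext =
  let (a , b , 1≤a , 1≤b , p≐a/b) = positive⇒fraction p 0<p
      M = (l + 1) * d
      1≤bᴹ = m^n>0 b {{>-nonZero 1≤b}} M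
      pᴹ≐aᴹ/bᴹ = ≐-^ℚ M p≐a/b
      (X , X-dense , X-extending) = dependent-random-choice G t d h {{>-nonZero 1≤n}} {{>-nonZero 1≤a}}
        (trans (*-distribʳ-+ d l 1) (cong (l * d +_) (*-identityˡ d)))
        2≤d (<ℚ½⇒ p≐a/b 1≤b p<½)
        (Equivalence.to (1≤ℚ⇔ (≐-*ℕ→ℚ n pᴹ≐aᴹ/bᴹ) 1≤bᴹ) 1≤pᴹn)
        (Equivalence.to (≤ℚℕ→ℚ⇔ (numEdges G) (≐-*ℕ→ℚ (n ^ suc k′) p≐a/b) 1≤b) dense)
        few ext
  in extendedBy G t X , extendedBy-⊆ G t X ,
     Equivalence.from (≤ℚℕ→ℚ⇔ _ (≐-*ℕ→ℚ (n ^ suc k′) pᴹ≐aᴹ/bᴹ) 1≤bᴹ) X-dense , X-extending
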